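{- For every integer $n\ge 2$, the Möbius ladder $M_{2n}$ is neighborhood-prime.
   Context: A neighborhood-prime labeling of a simple graph $G$ with $N$ vertices is a bijection $f:V(G)\to\{1,\ldots,N\}$ such that for every vertex $v$ with $\deg(v)>1$, $\gcd\{f(u):u\in N(v)\}=1$, where $N(v)$ is the neighborhood of $v$; a graph admitting one is neighborhood-prime. The Möbius ladder $M_{2n}$ has vertices $v_1,\ldots,v_n,u_1,\ldots,u_n$ and edges $v_iv_{i+1}$ and $u_iu_{i+1}$ for $i=1,\ldots,n-1$, $v_iu_i$ for $i=1,\ldots,n$ (this is the ladder $P_n\times P_2$), together with the two edges $v_1u_n$ and $u_1v_n$. -}

module Defs where

open import Data.Nat using (ℕ; zero; suc; _+_; _*_; _<_)
open import Data.Nat.Divisibility using (_∣_)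
open import Data.Nat.Properties using (_≟_)
open import Data.Fin using (Fin; toℕ)
open import Data.Sum using (_⊎_; inj₁; inj₂)
open import Data.Product using (_×_; Σ)
open import Data.List using (List; length; filter)
open import Data.List using (allFin; map; _++_)
open import Relation.Binary.PropositionalEquality using (_≡_)
open import Relation.Nullary using (Dec; yes; no; ¬_)
open import Relation.Nullary.Decidable using (_⊎-dec_; _×-dec_)
open import Function.Bundles using (_⤖_; Bijection)

record Graph : Set₁ where
  field
    V        : Set
    N        : ℕ
    vertices : List V                     -- enumeration of V without repetition
    Adj      : V → V → Set
    adj?     : (x y : V) → Dec (Adj x y)

open Graph public

degree : (G : Graph) → V G → ℕ
degree G v = length (filter (adj? G v) (vertices G))

-- A neighborhood-prime labeling: bijection f : V → {1,…,N}, encoded as a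
-- bijection V ↔ Fin N with label f(v) = toℕ (g v) + 1, such that for every
-- vertex of degree > 1 the gcd of the labels of its neighbours is 1, i.e.
-- every common divisor of all neighbour labels equals 1.
label : {G : Graph} → (V G ⤖ Fin (N G)) → V G → ℕ
label f v = suc (toℕ (Bijection.to f v))

IsNeighborhoodPrimeLabeling : (G : Graph) → (V G ⤖ Fin (N G)) → Set
IsNeighborhoodPrimeLabeling G f =
  (v : V G) → 1 < degree G v →
    (d : ℕ) → ((u : V G) → Adj G v u → d ∣ label {G} f u) → d ≡ 1

NeighborhoodPrime : Graph → Set
NeighborhoodPrime G = Σ ((V G ⤖ Fin (N G))) (IsNeighborhoodPrimeLabeling G)

-- Möbius ladder M_{2n}: vertices inj₁ i = v_{i+1}, inj₂ i = u_{i+1}, i ∈ Fin n.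
-- Edges: v_i v_{i+1}, u_i u_{i+1} (1 ≤ i ≤ n-1), v_i u_i, v_1 u_n, u_1 v_n.
MEdge : (n : ℕ) → Fin n ⊎ Fin n → Fin n ⊎ Fin n → Set
MEdge n (inj₁ i) (inj₁ j) = suc (toℕ i) ≡ toℕ j
MEdge n (inj₂ i) (inj₂ j) = suc (toℕ i) ≡ toℕ j
MEdge n (inj₁ i) (inj₂ j) = (toℕ i ≡ toℕ j) ⊎ ((toℕ i ≡ 0) × (suc (toℕ j) ≡ n))
MEdge n (inj₂ i) (inj₁ j) = (toℕ i ≡ 0) × (suc (toℕ j) ≡ n)

MEdge? : (n : ℕ) → (x y : Fin n ⊎ Fin n) → Dec (MEdge n x y)
MEdge? n (inj₁ i) (inj₁ j) = suc (toℕ i) ≟ toℕ j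
MEdge? n (inj₂ i) (inj₂ j) = suc (toℕ i) ≟ toℕ j
MEdge? n (inj₁ i) (inj₂ j) = (toℕ i ≟ toℕ j) ⊎-dec ((toℕ i ≟ 0) ×-dec (suc (toℕ j) ≟ n))
MEdge? n (inj₂ i) (inj₁ j) = (toℕ i ≟ 0) ×-dec (suc (toℕ j) ≟ n)

MAdj : (n : ℕ) → Fin n ⊎ Fin n → Fin n ⊎ Fin n → Set
MAdj n x y = MEdge n x y ⊎ MEdge n y x

MAdj? : (n : ℕ) → (x y : Fin n ⊎ Fin n) → Dec (MAdj n x y)
MAdj? n x y = MEdge? n x y ⊎-dec MEdge? n y x

MobiusLadder : ℕ → Graph
MobiusLadder n = record
  { V        = Fin n ⊎ Fin n
  ; N        = n + n
  ; vertices = map inj₁ (allFin n) ++ map inj₂ (allFin n)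
  ; Adj      = MAdj n
  ; adj?     = MAdj? n
  }

-- Label v_i with 2i − 1 and u_i with 2i, interleaving the two rails. Each u_{i+1} and each
-- interior v_i then has two neighbours with consecutive labels 2i and 2i + 1, u_1 is adjacent to
-- v_1 with label 1, and v_n is adjacent to u_1 with label 2 and to v_{n−1} with an odd label.
module Submission where

open import Defs
open import Data.Nat using (ℕ; zero; suc; pred; _+_; _*_; _≤_; _<_; s≤s; z≤n; s≤s⁻¹; >-nonZero)
open import Data.Nat.Properties using (+-comm; *-comm; *-suc; ≤-trans; ≤-<-trans; ≤∧≢⇒<; pred[n]≤n; suc-pred; _≟_)
open import Data.Nat.Divisibility using (_∣_; ∣1⇒≡1; ∣m+n∣m⇒∣n; ∣m⇒∣m*n)
open import Data.Nat.Coprimality using (Coprime; 1-coprimeTo)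
open import Data.Fin using (Fin; zero; suc; toℕ; cast; combine; remQuot; fromℕ<; inject₁)
open import Data.Fin.Properties
  using (toℕ-cast; toℕ-combine; remQuot-combine; combine-remQuot; cast-involutive;
         toℕ<n; toℕ-fromℕ<; toℕ-inject₁)
open import Data.Product using (Σ; _×_; _,_; uncurry)
open import Data.Sum using (inj₁; inj₂; _⊎_)
open import Function.Bundles using (_⤖_; mk↔ₛ′)
open import Function.Properties.Inverse using (↔⇒⤖)
open import Relation.Binary.PropositionalEquality
open import Relation.Nullary using (yes; no)

coprime-suc : ∀ m → Coprime m (suc m)
coprime-suc m {d} (d∣m , d∣1+m) =
  ∣1⇒≡1 (∣m+n∣m⇒∣n (subst (d ∣_) (+-comm 1 m) d∣1+m) d∣m)

coprime-2-odd : ∀ t → Coprime 2 (suc (2 * t))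
coprime-2-odd t (d∣2 , d∣odd) = coprime-suc (2 * t) (∣m⇒∣m*n t d∣2 , d∣odd)

module _ (G : Graph) (f : V G ⤖ Fin (N G)) where

  CoprimeNeighbours : V G → Set
  CoprimeNeighbours v =
    Σ (V G) λ x → Σ (V G) λ y →
      Adj G v x × Adj G v y × Coprime (label {G} f x) (label {G} f y)

  coprimeNeighbours⇒neighborhoodPrime :
    (∀ v → CoprimeNeighbours v) → IsNeighborhoodPrimeLabeling G f
  coprimeNeighbours⇒neighborhoodPrime nbrs v _ d d∣nbr =
    let (x , y , vx , vy , coprime) = nbrs v in coprime (d∣nbr x vx , d∣nbr y vy)

module Interleave (n : ℕ) where

  n*2≡n+n : n * 2 ≡ n + n
  n*2≡n+n = trans (*-comm n 2) (cong (n +_) (+-comm n 0))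

  to : Fin n ⊎ Fin n → Fin (n + n)
  to (inj₁ i) = cast n*2≡n+n (combine i zero)
  to (inj₂ i) = cast n*2≡n+n (combine i (suc zero))

  fromPair : Fin n × Fin 2 → Fin n ⊎ Fin n
  fromPair (i , zero)     = inj₁ i
  fromPair (i , suc zero) = inj₂ i

  from : Fin (n + n) → Fin n ⊎ Fin n
  from k = fromPair (remQuot 2 (cast (sym n*2≡n+n) k))

  from∘to : ∀ x → from (to x) ≡ x
  from∘to (inj₁ i) rewrite cast-involutive (sym n*2≡n+n) n*2≡n+n (combine {n} {2} i zero)
                         | remQuot-combine {n} {2} i zero = refl
  from∘to (inj₂ i) rewrite cast-involutive (sym n*2≡n+n) n*2≡n+n (combine {n} {2} i (suc zero))
                         | remQuot-combine {n} {2} i (suc zero) = refl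

  to∘fromPair : ∀ p → to (fromPair p) ≡ cast n*2≡n+n (uncurry combine p)
  to∘fromPair (i , zero)     = refl
  to∘fromPair (i , suc zero) = refl

  to∘from : ∀ k → to (from k) ≡ k
  to∘from k = begin
    to (from k)                                           ≡⟨ to∘fromPair (remQuot 2 k′) ⟩
    cast n*2≡n+n (uncurry combine (remQuot {n} 2 k′))     ≡⟨ cong (cast n*2≡n+n) (combine-remQuot {n} 2 k′) ⟩
    cast n*2≡n+n k′                                       ≡⟨ cast-involutive n*2≡n+n (sym n*2≡n+n) k ⟩
    k                                                     ∎
    where
    open ≡-Reasoning
    k′ = cast (sym n*2≡n+n) k

interleave : (n : ℕ) → (Fin n ⊎ Fin n) ⤖ Fin (n + n)
interleave n = ↔⇒⤖ (mk↔ₛ′ to from to∘from from∘to)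
  where open Interleave n

private
  variable
    n : ℕ

  lab : Fin n ⊎ Fin n → ℕ
  lab {n} = label {MobiusLadder n} (interleave n)

label-v : (i : Fin n) → lab (inj₁ i) ≡ suc (2 * toℕ i)
label-v i = cong suc (begin
  toℕ (cast _ (combine i zero))   ≡⟨ toℕ-cast _ (combine i zero) ⟩
  toℕ (combine i (zero {1}))      ≡⟨ toℕ-combine i (zero {1}) ⟩
  2 * toℕ i + 0                   ≡⟨ +-comm (2 * toℕ i) 0 ⟩
  2 * toℕ i                       ∎)
  where open ≡-Reasoning

label-u : (i : Fin n) → lab (inj₂ i) ≡ 2 * suc (toℕ i)
label-u i = begin
  suc (toℕ (cast _ (combine i (suc zero))))   ≡⟨ cong suc (toℕ-cast _ (combine i (suc zero))) ⟩
  suc (toℕ (combine i (suc (zero {0}))))      ≡⟨ cong suc (toℕ-combine i (suc (zero {0}))) ⟩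
  suc (2 * toℕ i + 1)                         ≡⟨ cong suc (+-comm (2 * toℕ i) 1) ⟩
  2 + 2 * toℕ i                               ≡⟨ sym (*-suc 2 (toℕ i)) ⟩
  2 * suc (toℕ i)                             ∎
  where open ≡-Reasoning

labelledNeighbours : ∀ {v} (x y : Fin n ⊎ Fin n) {a b} → MAdj n v x → MAdj n v y →
                     lab x ≡ a → lab y ≡ b → Coprime a b →
                     CoprimeNeighbours (MobiusLadder n) (interleave n) v
labelledNeighbours x y vx vy x≡a y≡b coprime = x , y , vx , vy , subst₂ Coprime (sym x≡a) (sym y≡b) coprime

coprimeNeighbours-u₁ : CoprimeNeighbours (MobiusLadder (suc n)) (interleave (suc n)) (inj₂ zero)
coprimeNeighbours-u₁ {n} = labelledNeighbours (inj₁ zero) (inj₁ zero) v₁u₁ v₁u₁ v₁≡1 v₁≡1 (1-coprimeTo 1)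
  where
  v₁u₁ : MAdj (suc n) (inj₂ zero) (inj₁ zero)
  v₁u₁ = inj₂ (inj₁ refl)
  v₁≡1 : lab {suc n} (inj₁ zero) ≡ 1
  v₁≡1 = label-v {suc n} zero

coprimeNeighbours-uₖ₊₁ : (k : Fin n) →
                         CoprimeNeighbours (MobiusLadder (suc n)) (interleave (suc n)) (inj₂ (suc k))
coprimeNeighbours-uₖ₊₁ k = labelledNeighbours (inj₂ (inject₁ k)) (inj₁ (suc k))
  (inj₂ (cong suc (toℕ-inject₁ k))) (inj₂ (inj₁ refl))
  (trans (label-u (inject₁ k)) (cong (λ t → 2 * suc t) (toℕ-inject₁ k))) (label-v (suc k))
  (coprime-suc (2 * suc (toℕ k)))

coprimeNeighbours-vᵢ : (i : Fin n) → suc (toℕ i) < n →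
                       CoprimeNeighbours (MobiusLadder n) (interleave n) (inj₁ i)
coprimeNeighbours-vᵢ i next<n = labelledNeighbours (inj₂ i) (inj₁ next)
  (inj₁ (inj₁ refl)) (inj₁ (sym toℕ-next))
  (label-u i) (trans (label-v next) (cong (λ t → suc (2 * t)) toℕ-next))
  (coprime-suc (2 * suc (toℕ i)))
  where
  next = fromℕ< next<n
  toℕ-next = toℕ-fromℕ< next<n

coprimeNeighbours-vₙ : 2 ≤ n → (i : Fin n) → suc (toℕ i) ≡ n →
                       CoprimeNeighbours (MobiusLadder n) (interleave n) (inj₁ i)
coprimeNeighbours-vₙ {n} 2≤n i last = labelledNeighbours (inj₂ first) (inj₁ prev)
  (inj₂ (toℕ-first , last)) (inj₂ (trans (cong suc toℕ-prev) 1+t≡i))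
  (trans (label-u first) (cong (λ s → 2 * suc s) toℕ-first))
  (trans (label-v prev) (cong (λ s → suc (2 * s)) toℕ-prev))
  (coprime-2-odd t)
  where
  t = pred (toℕ i)
  0<i : 0 < toℕ i
  0<i = s≤s⁻¹ (subst (2 ≤_) (sym last) 2≤n)
  1+t≡i : suc t ≡ toℕ i
  1+t≡i = suc-pred (toℕ i) {{>-nonZero 0<i}}
  0<n : 0 < n
  0<n = ≤-trans (s≤s z≤n) 2≤n
  t<n : t < n
  t<n = ≤-<-trans pred[n]≤n (toℕ<n i)
  first = fromℕ< 0<n
  toℕ-first = toℕ-fromℕ< 0<n
  prev = fromℕ< t<n
  toℕ-prev = toℕ-fromℕ< t<n

mobiusCoprimeNeighbours : 2 ≤ n → ∀ v → CoprimeNeighbours (MobiusLadder n) (interleave n) v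
mobiusCoprimeNeighbours _ (inj₂ zero)    = coprimeNeighbours-u₁
mobiusCoprimeNeighbours _ (inj₂ (suc k)) = coprimeNeighbours-uₖ₊₁ k
mobiusCoprimeNeighbours {n} 2≤n (inj₁ i) with suc (toℕ i) ≟ n
... | no  notLast = coprimeNeighbours-vᵢ i (≤∧≢⇒< (toℕ<n i) notLast)
... | yes last    = coprimeNeighbours-vₙ 2≤n i last

mainTheorem9 : (n : ℕ) → 2 ≤ n → NeighborhoodPrime (MobiusLadder n)
mainTheorem9 n 2≤n =
  interleave n ,
  coprimeNeighbours⇒neighborhoodPrime (MobiusLadder n) (interleave n) (mobiusCoprimeNeighbours 2≤n)
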